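{- Let $a=a_1,a_2,\ldots,a_n$ be a feasible sequence, and let $k\ge 1$ and $m\ge 0$ be integers with $k+m\le n$ such that $a_k=a_{k+1}=\cdots=a_{k+m}$. Then $\sum_{i=1}^k a_i \le k(n-k)-m$.
   Context: A non-increasing sequence of integers $a=a_1,a_2,\ldots,a_n$ is called feasible if $\sum_{i=1}^n a_i=0$ and $\sum_{i=1}^k a_i\le k(n-k)$ for all $1\le k\le n$. -}

module Defs where

open import Data.Nat using (ℕ; zero; suc; _≤_; _<_; _∸_)
open import Data.Integer using (ℤ; _+_; _*_; +_; 0ℤ) renaming (_≤_ to _≤ℤ_)
open import Data.Fin using (Fin; toℕ)
open import Relation.Binary.PropositionalEquality using (_≡_)

-- A sequence a_1,...,a_n is represented as a function a : Fin n → ℤ,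
-- where a_i (1-based) is  a (i-1)  for i = 1..n.

-- prefix sum  Σ_{i=1}^k a_i  (terms with index > n are ignored;
-- only used for k ≤ n)
prefixSum : ∀ {n} → (Fin n → ℤ) → ℕ → ℤ
prefixSum {zero}  a k       = 0ℤ
prefixSum {suc n} a zero    = 0ℤ
prefixSum {suc n} a (suc k) = a Fin.zero + prefixSum (λ i → a (Fin.suc i)) k
  where import Data.Fin as Fin

total : ∀ {n} → (Fin n → ℤ) → ℤ
total {n} a = prefixSum a n

NonIncreasing : ∀ {n} → (Fin n → ℤ) → Set
NonIncreasing {n} a = ∀ (i j : Fin n) → toℕ i ≤ toℕ j → a j ≤ℤ a i

Feasible : ∀ {n} → (Fin n → ℤ) → Set
Feasible {n} a =
  NonIncreasing a × (total a ≡ 0ℤ) ×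
  (∀ (k : ℕ) → 1 ≤ k → k ≤ n → prefixSum a k ≤ℤ (+ k) * (+ (n ∸ k)))
  where open import Data.Product using (_×_)

-- Write c for the
-- common value of the run, so that s_{k+m} = s_k + m c and s_{k-1} = s_k - c.
-- If c ≥ n - 2k - m + 1, the bound at k + m gives
-- s_k ≤ (k+m)(n-k-m) - m c ≤ k(n-k) - m; otherwise the bound at k - 1 gives
-- s_k ≤ (k-1)(n-k+1) + c ≤ k(n-k) - m - 1.
module Submission where

open import Defs
open import Data.Nat using (ℕ; _≤_; _+_; _∸_)
open import Data.Integer using (ℤ; +_; _*_; _-_) renaming (_≤_ to _≤ℤ_)
open import Data.Fin using (Fin; toℕ)
open import Relation.Binary.PropositionalEquality using (_≡_)

open import Data.Nat using (zero; suc; s≤s; z≤n; _<_)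
import Data.Nat.Properties as ℕ
open import Data.Integer using (0ℤ; 1ℤ; -_; +≤+; nonNegative) renaming (_+_ to _+ℤ_; _≤?_ to _≤ℤ?_)
import Data.Integer.Properties as ℤ
open import Data.Integer.Tactic.RingSolver using (solve)
import Data.Fin as Fin
open import Data.Fin using (fromℕ<)
open import Data.Fin.Properties using (toℕ-fromℕ<)
open import Data.List using (_∷_; [])
open import Data.Vec.Functional using (tail)
open import Data.Product using (_,_)
open import Relation.Binary.PropositionalEquality
  using (refl; sym; trans; cong; cong₂; subst; module ≡-Reasoning)
open import Relation.Nullary using (yes; no)

pos-∸ : ∀ {m n} → n ≤ m → + (m ∸ n) ≡ + m - + n
pos-∸ {m} {n} n≤m = trans (sym (ℤ.⊖-≥ n≤m)) (sym (ℤ.m-n≡m⊖n m n))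

prefixSum-zero : ∀ {n} (a : Fin n → ℤ) → prefixSum a 0 ≡ 0ℤ
prefixSum-zero {zero}  a = refl
prefixSum-zero {suc n} a = refl

prefixSum-suc : ∀ {n} (a : Fin n → ℤ) j (j<n : j < n) →
                prefixSum a (suc j) ≡ prefixSum a j +ℤ a (fromℕ< j<n)
prefixSum-suc {suc n} a zero    j<n       =
  trans (cong (a Fin.zero +ℤ_) (prefixSum-zero (tail a))) (ℤ.+-comm (a Fin.zero) 0ℤ)
prefixSum-suc {suc n} a (suc j) (s≤s j<n) = begin
  a Fin.zero +ℤ prefixSum (tail a) (suc j)
    ≡⟨ cong (a Fin.zero +ℤ_) (prefixSum-suc (tail a) j j<n) ⟩
  a Fin.zero +ℤ (prefixSum (tail a) j +ℤ a (fromℕ< (s≤s j<n)))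
    ≡⟨ ℤ.+-assoc (a Fin.zero) _ _ ⟨
  a Fin.zero +ℤ prefixSum (tail a) j +ℤ a (fromℕ< (s≤s j<n)) ∎
  where open ≡-Reasoning

prefixSum-constantRun : ∀ {n} (a : Fin n → ℤ) (c : ℤ) j t → j + t ≤ n →
  (∀ i → j ≤ toℕ i → toℕ i < j + t → a i ≡ c) →
  prefixSum a (j + t) ≡ prefixSum a j +ℤ + t * c
prefixSum-constantRun a c j zero    _     _   rewrite ℕ.+-identityʳ j =
  sym (trans (cong (prefixSum a j +ℤ_) (ℤ.*-zeroˡ c)) (ℤ.+-identityʳ _))
prefixSum-constantRun a c j (suc t) j+t<n run rewrite ℕ.+-suc j t = begin
  prefixSum a (suc (j + t))          ≡⟨ prefixSum-suc a (j + t) j+t<n ⟩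
  prefixSum a (j + t) +ℤ a (fromℕ< j+t<n)
    ≡⟨ cong₂ _+ℤ_ (prefixSum-constantRun a c j t (ℕ.<⇒≤ j+t<n) run′) last ⟩
  prefixSum a j +ℤ + t * c +ℤ c      ≡⟨ oneMore (prefixSum a j) (+ t) ⟩
  prefixSum a j +ℤ (1ℤ +ℤ + t) * c   ∎
  where
  open ≡-Reasoning
  oneMore : ∀ s x → s +ℤ x * c +ℤ c ≡ s +ℤ (1ℤ +ℤ x) * c
  oneMore s x = solve (s ∷ x ∷ c ∷ [])
  run′ : ∀ i → j ≤ toℕ i → toℕ i < j + t → a i ≡ c
  run′ i j≤i i<j+t = run i j≤i (ℕ.m<n⇒m<1+n i<j+t)
  last : a (fromℕ< j+t<n) ≡ c
  last = run (fromℕ< j+t<n)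
    (subst (j ≤_) (sym (toℕ-fromℕ< j+t<n)) (ℕ.m≤m+n j t))
    (subst (_< suc (j + t)) (sym (toℕ-fromℕ< j+t<n)) ℕ.≤-refl)

prefixSum≤ : ∀ {n} (a : Fin n → ℤ) → Feasible a →
             ∀ k → k ≤ n → prefixSum a k ≤ℤ + k * (+ n - + k)
prefixSum≤ {n} a _               zero    _   =
  ℤ.≤-reflexive (trans (prefixSum-zero a) (sym (ℤ.*-zeroˡ (+ n - 0ℤ))))
prefixSum≤     a (_ , _ , bound) (suc k) k<n =
  subst (λ d → prefixSum a (suc k) ≤ℤ + suc k * d) (pos-∸ k<n)
        (bound (suc k) (s≤s z≤n) k<n)

-- Here k is the paper's k - 1, P = s_{k-1} and c is the value of the run.
constantRun-bound : ∀ (k m n c P : ℤ) → 0ℤ ≤ℤ m →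
  P +ℤ c +ℤ m * c ≤ℤ (1ℤ +ℤ k +ℤ m) * (n - (1ℤ +ℤ k +ℤ m)) →
  P ≤ℤ k * (n - k) →
  P +ℤ c ≤ℤ (1ℤ +ℤ k) * (n - (1ℤ +ℤ k)) - m
constantRun-bound k m n c P 0≤m upper lower
  with n - (1ℤ +ℤ k +ℤ m) - k ≤ℤ? c
... | yes d≤c = begin
  P +ℤ c                                  ≡⟨ solve (P ∷ c ∷ m ∷ []) ⟩
  P +ℤ c +ℤ m * c - m * c                 ≤⟨ ℤ.+-monoˡ-≤ (- (m * c)) upper ⟩
  (1ℤ +ℤ k +ℤ m) * (n - (1ℤ +ℤ k +ℤ m)) - m * c
    ≤⟨ ℤ.+-monoʳ-≤ ((1ℤ +ℤ k +ℤ m) * (n - (1ℤ +ℤ k +ℤ m)))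
         (ℤ.neg-mono-≤ (ℤ.*-monoˡ-≤-nonNeg m {{nonNegative 0≤m}} d≤c)) ⟩
  (1ℤ +ℤ k +ℤ m) * (n - (1ℤ +ℤ k +ℤ m)) - m * (n - (1ℤ +ℤ k +ℤ m) - k)
                                          ≡⟨ solve (k ∷ m ∷ n ∷ []) ⟩
  (1ℤ +ℤ k) * (n - (1ℤ +ℤ k)) - m         ∎
  where open ℤ.≤-Reasoning
... | no d≰c = begin
  P +ℤ c                                  ≡⟨ solve (P ∷ c ∷ []) ⟩
  P +ℤ (1ℤ +ℤ c) - 1ℤ                     ≤⟨ ℤ.+-monoˡ-≤ (- 1ℤ) (ℤ.+-mono-≤ lower c<d) ⟩
  k * (n - k) +ℤ (n - (1ℤ +ℤ k +ℤ m) - k) - 1ℤ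
                                          ≡⟨ solve (k ∷ m ∷ n ∷ []) ⟩
  (1ℤ +ℤ k) * (n - (1ℤ +ℤ k)) - m - 1ℤ    ≤⟨ ℤ.i-j≤i _ 1ℤ ⟩
  (1ℤ +ℤ k) * (n - (1ℤ +ℤ k)) - m         ∎
  where
  open ℤ.≤-Reasoning
  c<d : 1ℤ +ℤ c ≤ℤ n - (1ℤ +ℤ k +ℤ m) - k
  c<d = ℤ.i<j⇒suc[i]≤j (ℤ.≰⇒> d≰c)

lemma2 : ∀ (n : ℕ) (a : Fin n → ℤ) → Feasible a →
    ∀ (k m : ℕ) → 1 ≤ k → k + m ≤ n →
    (∀ (i j : Fin n) → k ≤ toℕ i + 1 → toℕ i + 1 ≤ k + m →
                       k ≤ toℕ j + 1 → toℕ j + 1 ≤ k + m → a i ≡ a j) →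
    prefixSum a k ≤ℤ (+ k) * (+ (n ∸ k)) - (+ m)
lemma2 n a feasible (suc k) m (s≤s z≤n) k+m≤n same =
  subst (λ d → prefixSum a (suc k) ≤ℤ + suc k * d - + m) (sym (pos-∸ k<n))
    (subst (_≤ℤ _) (sym (prefixSum-suc a k k<n))
      (constantRun-bound (+ k) (+ m) (+ n) c (prefixSum a k) (+≤+ z≤n)
        (subst (_≤ℤ _) sum-to-end (prefixSum≤ a feasible (suc k + m) k+m≤n))
        (prefixSum≤ a feasible k (ℕ.<⇒≤ k<n))))
  where
  k<n : k < n
  k<n = ℕ.≤-trans (ℕ.m≤m+n (suc k) m) k+m≤n
  c : ℤ
  c = a (fromℕ< k<n)
  lowerEnd : ∀ {x} → k ≤ x → suc k ≤ x + 1
  lowerEnd {x} k≤x = subst (suc k ≤_) (ℕ.+-comm 1 x) (s≤s k≤x)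
  upperEnd : ∀ {x} → x < suc k + m → x + 1 ≤ suc k + m
  upperEnd {x} = subst (_≤ suc k + m) (ℕ.+-comm 1 x)
  inRun : ∀ i → k ≤ toℕ i → toℕ i < suc k + m → a i ≡ c
  inRun i k≤i i<k+m = same i (fromℕ< k<n)
    (lowerEnd k≤i) (upperEnd i<k+m)
    (lowerEnd (ℕ.≤-reflexive (sym (toℕ-fromℕ< k<n))))
    (upperEnd (subst (_< suc k + m) (sym (toℕ-fromℕ< k<n)) (ℕ.m≤m+n (suc k) m)))
  sum-to-end : prefixSum a (suc k + m) ≡ prefixSum a k +ℤ c +ℤ + m * c
  sum-to-end = begin
    prefixSum a (suc k + m)             ≡⟨ prefixSum-constantRun a c (suc k) m k+m≤n
                                             (λ i k<i → inRun i (ℕ.<⇒≤ k<i)) ⟩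
    prefixSum a (suc k) +ℤ + m * c      ≡⟨ cong (_+ℤ + m * c) (prefixSum-suc a k k<n) ⟩
    prefixSum a k +ℤ c +ℤ + m * c       ∎
    where open ≡-Reasoning
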